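{- If an equation $\varepsilon$ fails in a compatible surjection, then it fails in a diagram based on a chain of size up to $|\Delta_\varepsilon|$.
   Context: Write $x^{(0)}=x$, $x^{(m)}=x^{\ell^m}$ and $x^{(-m)}=x^{r^m}$ for $m\in\mathbb{Z}^+$. The equation $\varepsilon$ over variables $x_1,\ldots,x_n$ is in intentional form $1\leq w_1\vee\cdots\vee w_k$, where each $w_j$ is a (possibly empty) product of terms $x_i^{(m)}$. Terms are taken in the language of intentional terms expanded by two constants $+$ and $-$. $FS_\varepsilon$ is the set of final subwords $u$ of the $w_j$ ($w_j=vu$), including $1$. For a variable $x$, $m\in\mathbb{N}$, $v\in FS_\varepsilon$: $\Delta^v_{x,m}=\{v\}\cup\bigcup_{j=0}^m\{\sigma_jx^{(j)}\cdots\sigma_mx^{(m)}v:\sigma_j,\ldots,\sigma_m\in\{ -1,0\},\sigma_0=0\}$ and $\Delta^v_{x,-m}=\{v\}\cup\bigcup_{j=0}^m\{\sigma_jx^{(-j)}\cdots\sigma_mx^{(-m)}v:\sigma_j,\ldots,\sigma_m\in\{1,0\},\sigma_0=0\}$ ($\sigma=-1$: factor $-$; $\sigma=1$: factor $+$; $\sigma=0$: no factor). $S_\varepsilon=\{(i,m,v): x_i^{(m)}v\in FS_\varepsilon, v\in FS_\varepsilon\}$ and $\Delta_\varepsilon=\{1\}\cup\bigcup_{(i,m,v)\in S_\varepsilon}\Delta^v_{x_i,m}$ (finite). A c-chain is a triple $(\Delta,\leq,\lessdot)$ with $(\Delta,\leq)$ a finite chain and $\lessdot$ a subset of its covering relation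 $\prec$. For an order-preserving partial function $g$ on it: $(x,b)\in g^{[\ell]}$ iff $b\in Dom(g)$ and some $a\in Dom(g)$ has $a\lessdot b$ and $g(a)<x\leq g(b)$; $(x,a)\in g^{[r]}$ iff $a\in Dom(g)$ and some $b\in Dom(g)$ has $a\lessdot b$ and $g(a)\leq x<g(b)$; $g^{[0]}=g$, $g^{[k+1]}=(g^{[k]})^{[\ell]}$, $g^{[-(k+1)]}=(g^{[-k]})^{[r]}$. $\mathbf{Pf}(\mathbf{\Delta})$ is the algebra of order-preserving partial functions on the c-chain under composition, $^{[\ell]}$, $^{[r]}$ and the identity. A diagram $(\mathbf{\Delta},f_1,\ldots,f_n)$ is a finite c-chain with order-preserving partial functions $f_1,\ldots,f_n$ on it; $\varepsilon$ fails in it if there is a homomorphism $\psi$ from intentional terms to $\mathbf{Pf}(\mathbf{\Delta})$ (preserving multiplication, $1$ and the inverses) with $\psi(x_i)=f_i$ and a point $p$ with $\psi(1)(p)>\psi(w_j)(p)$ for all $j$. A compatible surjection for $\varepsilon$ is an onto map $\varphi:\Delta_\varepsilon\to\mathbb{N}_q=\{1,\ldots,q\}$ such that: (i) each $g_i:=\{(\varphi(u),\varphi(x_iu)):u,x_iu\in\Delta_\varepsilon\}$ is an order-preserving partial function; (ii) $\lessdot:=\{(\varphi(v),\varphi(+v)):v,+v\in\Delta_\varepsilon\}\cup\{(\varphi(-v),\varphi(v)):v,-v\in\Delta_\varepsilon\}$ is contained in the covering relation of $\mathbb{N}_q$; (iii) $\varphi(x_i^{(m)}u)=g_i^{[m]}(\varphi(u))$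 whenever $u,x_i^{(m)}u\in\Delta_\varepsilon$, computed in $(\mathbb{N}_q,\leq,\lessdot)$. $\varepsilon$ fails in $\varphi$ if $\varphi(w_j)<\varphi(1)$ for all $j$. -}

module Defs where

open import Data.Nat as ℕ using (ℕ; zero; suc; _∸_)
open import Data.Integer as ℤ using (ℤ; +_; -[1+_]; -_)
open import Data.Fin as Fin using (Fin; toℕ)
open import Data.Product using (Σ; ∃; ∃-syntax; _×_; _,_)
open import Data.Sum using (_⊎_)
open import Data.List using (List; []; _∷_; map; concatMap; upTo; length; deduplicate)
open import Data.List.Membership.Propositional using (_∈_)
import Data.List.Properties as LP
open import Relation.Binary.PropositionalEquality using (_≡_; refl; cong; cong₂)
open import Relation.Binary.Definitions using (DecidableEquality)
open import Relation.Nullary using (yes; no)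

-- An atom  x_i^{(m)}  over the variables x_0, …, x_{n-1};  m ∈ ℤ.
Atom : ℕ → Set
Atom n = Fin n × ℤ

-- A product of atoms (the empty list is the identity 1).
AWord : ℕ → Set
AWord n = List (Atom n)

-- An equation 1 ≤ w₁ ∨ ⋯ ∨ wₖ is given by its list of joinands.
Equation : ℕ → Set
Equation n = List (AWord n)

-- Letters of the language expanded by the constants + and −.
data Letter (n : ℕ) : Set where
  atm   : Fin n → ℤ → Letter n
  plus  : Letter n
  minus : Letter n

Word : ℕ → Set
Word n = List (Letter n)

embed : ∀ {n} → AWord n → Word n
embed = map (λ { (i , m) → atm i m })

_≟L_ : ∀ {n} → DecidableEquality (Letter n)
atm i m ≟L atm j k with i Fin.≟ j | m ℤ.≟ k
... | yes refl | yes refl = yes refl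
... | no ne | _ = no λ { refl → ne refl }
... | yes _ | no ne = no λ { refl → ne refl }
atm _ _ ≟L plus = no λ ()
atm _ _ ≟L minus = no λ ()
plus ≟L atm _ _ = no λ ()
plus ≟L plus = yes refl
plus ≟L minus = no λ ()
minus ≟L atm _ _ = no λ ()
minus ≟L plus = no λ ()
minus ≟L minus = yes refl

_≟W_ : ∀ {n} → DecidableEquality (Word n)
_≟W_ = LP.≡-dec _≟L_

finals : ∀ {A : Set} → List A → List (List A)
finals [] = [] ∷ []
finals (a ∷ as) = (a ∷ as) ∷ finals as

FS : ∀ {n} → Equation n → List (Word n)
FS ε = [] ∷ concatMap (λ w → finals (embed w)) ε

module _ {n : ℕ} (sym : Letter n) (ex : ℕ → ℤ) (i : Fin n) (v : Word n) where

  -- the optional factor σ_j in front of t (σ_0 = 0 forced)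
  opt : ℕ → Word n → List (Word n)
  opt zero t = t ∷ []
  opt (suc _) t = t ∷ (sym ∷ t) ∷ []

  -- blocks j d = { σ_j x^{(ex j)} σ_{j+1} x^{(ex (j+1))} ⋯ σ_{j+d} x^{(ex (j+d))} v }
  blocks : ℕ → ℕ → List (Word n)
  blocks j zero = opt j (atm i (ex j) ∷ v)
  blocks j (suc d) = concatMap (λ t → opt j (atm i (ex j) ∷ t)) (blocks (suc j) d)

  DeltaGen : ℕ → List (Word n)
  DeltaGen m = v ∷ concatMap (λ j → blocks j (m ∸ j)) (upTo (suc m))

Delta : ∀ {n} → Fin n → ℤ → Word n → List (Word n)
Delta i (+ m) v = DeltaGen minus (λ j → + j) i v m
Delta i -[1+ k ] v = DeltaGen plus (λ j → - (+ j)) i v (suc k)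

DeltaOf : ∀ {n} → Word n → List (Word n)
DeltaOf (atm i m ∷ v) = Delta i m v
DeltaOf _ = []

-- Δ_ε = {1} ∪ ⋃_{(i,m,v) ∈ S_ε} Δ^v_{x_i,m}  (as a list, possibly with repetitions)
Δε : ∀ {n} → Equation n → List (Word n)
Δε ε = [] ∷ concatMap DeltaOf (FS ε)

cardΔε : ∀ {n} → Equation n → ℕ
cardΔε ε = length (deduplicate _≟W_ (Δε ε))

-- PRel N: a binary relation  g x y  read as "g(x) = y"
PRel : ℕ → Set₁
PRel N = Fin N → Fin N → Set

IsOPPartialFunction : ∀ {N} → PRel N → Set
IsOPPartialFunction g =
  (∀ x y y′ → g x y → g x y′ → y ≡ y′) ×
  (∀ x x′ y y′ → x Fin.≤ x′ → g x y → g x′ y′ → y Fin.≤ y′)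

InCovering : ∀ {N} → PRel N → Set
InCovering {N} cov = ∀ a b → cov a b → toℕ b ≡ suc (toℕ a)

module Lifts {N : ℕ} (cov : PRel N) where

  liftℓ : PRel N → PRel N
  liftℓ g x b =
    (∃[ gb ] g b gb) ×
    (∃[ a ] cov a b × ∃[ ga ] ∃[ gb ] (g a ga × g b gb × ga Fin.< x × x Fin.≤ gb))

  liftr : PRel N → PRel N
  liftr g x a =
    (∃[ ga ] g a ga) ×
    (∃[ b ] cov a b × ∃[ ga ] ∃[ gb ] (g a ga × g b gb × ga Fin.≤ x × x Fin.< gb))

  iterℓ : ℕ → PRel N → PRel N
  iterℓ zero g = g
  iterℓ (suc k) g = liftℓ (iterℓ k g)

  iterr : ℕ → PRel N → PRel N
  iterr zero g = g
  iterr (suc k) g = liftr (iterr k g)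

  iter : ℤ → PRel N → PRel N
  iter (+ k) g = iterℓ k g
  iter -[1+ k ] g = iterr (suc k) g

  compose : PRel N → PRel N → PRel N
  compose f g x z = ∃[ y ] (g x y × f y z)

  identity : PRel N
  identity x y = x ≡ y

record Diagram (n N : ℕ) : Set₁ where
  field
    cov      : PRel N
    cov-ok   : InCovering cov
    f        : Fin n → PRel N
    f-ok     : ∀ i → IsOPPartialFunction (f i)

module _ {n N : ℕ} (D : Diagram n N) where
  open Diagram D
  open Lifts cov

  ψAtom : Atom n → PRel N
  ψAtom (i , m) = iter m (f i)

  ψ : AWord n → PRel N
  ψ [] = identity
  ψ (a ∷ w) = compose (ψAtom a) (ψ w)

FailsInDiagram : ∀ {n N} → Equation n → Diagram n N → Set
FailsInDiagram {n} {N} ε D =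
  ∃[ p ] (∀ w → w ∈ ε → ∃[ y ] (ψ D w p y × y Fin.< p))

-- Compatible surjections (ℕ_q = {1,…,q} is represented by Fin q)

module _ {n : ℕ} (ε : Equation n) {q : ℕ} (φ : Word n → Fin q) where

  InΔ : Word n → Set
  InΔ u = u ∈ Δε ε

  gφ : Fin n → PRel q
  gφ i a b = ∃[ u ] (InΔ u × InΔ (atm i (+ 0) ∷ u) × φ u ≡ a × φ (atm i (+ 0) ∷ u) ≡ b)

  covφ : PRel q
  covφ a b =
    (∃[ v ] (InΔ v × InΔ (plus ∷ v) × φ v ≡ a × φ (plus ∷ v) ≡ b)) ⊎
    (∃[ v ] (InΔ v × InΔ (minus ∷ v) × φ (minus ∷ v) ≡ a × φ v ≡ b))

  record IsCompatibleSurjection : Set where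
    field
      onto  : ∀ k → ∃[ u ] (InΔ u × φ u ≡ k)
      condi : ∀ i → IsOPPartialFunction (gφ i)
      condii : InCovering covφ
      condiii : ∀ i m u → InΔ u → InΔ (atm i m ∷ u) →
                Lifts.iter covφ m (gφ i) (φ u) (φ (atm i m ∷ u))

  FailsInSurj : Set
  FailsInSurj = ∀ w → w ∈ ε → φ (embed w) Fin.< φ []

{-# OPTIONS --safe #-}
-- The compatible surjection φ already is a diagram: take the chain ℕ_q itself, with the
-- relation ⋖ and the partial functions g_i induced by φ.  Condition (iii) says that ψ(x_i^{(m)})
-- sends φ(u) to φ(x_i^{(m)} u), so by induction on w the map ψ(w) sends φ(1) to φ(w) for every
-- joinand w, and φ(w) < φ(1) is exactly failure at the point φ(1).  The chain has size q, and
-- q ≤ |Δ_ε| because φ maps Δ_ε onto ℕ_q.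
module Submission where

open import Defs
open import Data.Nat using (ℕ; zero; suc; _≤_; _∸_)
open import Data.Nat.Properties using (n∸n≡0; n<1+n)
open import Data.Integer using (ℤ; +_; -[1+_])
open import Data.Fin using (Fin)
open import Data.Fin.Properties using (injective⇒≤)
open import Data.Product using (∃-syntax; _×_; _,_; proj₁; proj₂)
open import Function using (_∘_)
open import Data.List using (List; []; _∷_; length; deduplicate; lookup)
open import Data.List.Relation.Unary.Any using (here; there; index)
import Data.List.Relation.Unary.Any as Any
open import Data.List.Relation.Unary.Any.Properties using (lookup-index)
open import Data.List.Membership.Propositional using (_∈_; lose)
open import Data.List.Membership.Propositional.Properties
  using (∈-concatMap⁺; ∈-concatMap⁻; ∈-upTo⁺; ∈-deduplicate⁺)
open import Relation.Binary.Definitions using (DecidableEquality)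
open import Relation.Binary.PropositionalEquality
  using (_≡_; refl; sym; trans; cong; subst; module ≡-Reasoning)

surjective⇒≤-length-deduplicate : ∀ {A : Set} (_≟_ : DecidableEquality A) (xs : List A)
  {q : ℕ} (f : A → Fin q) → (∀ k → ∃[ x ] (x ∈ xs × f x ≡ k)) →
  q ≤ length (deduplicate _≟_ xs)
surjective⇒≤-length-deduplicate _≟_ xs {q} f onto = injective⇒≤ section-injective
  where
  ∈-dedup : ∀ k → proj₁ (onto k) ∈ deduplicate _≟_ xs
  ∈-dedup k = ∈-deduplicate⁺ _≟_ (proj₁ (proj₂ (onto k)))

  section : Fin q → Fin (length (deduplicate _≟_ xs))
  section k = index (∈-dedup k)

  f∘lookup∘section≗id : ∀ k → f (lookup (deduplicate _≟_ xs) (section k)) ≡ k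
  f∘lookup∘section≗id k = trans (cong f (sym (lookup-index (∈-dedup k)))) (proj₂ (proj₂ (onto k)))

  section-injective : ∀ {k k′} → section k ≡ section k′ → k ≡ k′
  section-injective {k} {k′} eq = begin
    k                                             ≡⟨ sym (f∘lookup∘section≗id k) ⟩
    f (lookup (deduplicate _≟_ xs) (section k))   ≡⟨ cong (f ∘ lookup (deduplicate _≟_ xs)) eq ⟩
    f (lookup (deduplicate _≟_ xs) (section k′))  ≡⟨ f∘lookup∘section≗id k′ ⟩
    k′                                            ∎
    where open ≡-Reasoning

∈-finals : ∀ {A : Set} (xs : List A) → xs ∈ finals xs
∈-finals []       = here refl
∈-finals (_ ∷ _)  = here refl

finals-∷⁻ : ∀ {A : Set} (xs : List A) {a : A} {ys} → (a ∷ ys) ∈ finals xs → ys ∈ finals xs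
finals-∷⁻ []       (here ())
finals-∷⁻ []       (there ())
finals-∷⁻ (_ ∷ xs) (here refl) = there (∈-finals xs)
finals-∷⁻ (_ ∷ xs) (there p)   = there (finals-∷⁻ xs p)

module _ {n : ℕ} (ε : Equation n) where

  FS-∷⁻ : ∀ {a : Letter n} {u} → (a ∷ u) ∈ FS ε → u ∈ FS ε
  FS-∷⁻ (here ())
  FS-∷⁻ (there p) = there (∈-concatMap⁺ finalsOf
    (Any.map (λ {w} → finals-∷⁻ (embed w)) (∈-concatMap⁻ finalsOf {xs = ε} p)))
    where finalsOf = λ w → finals (embed w)

  embed-∈-FS : ∀ {w} → w ∈ ε → embed w ∈ FS ε
  embed-∈-FS w∈ε =
    there (∈-concatMap⁺ (λ w → finals (embed w)) (Any.map (λ { refl → ∈-finals _ }) w∈ε))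

  DeltaOf-FS⊆Δε : ∀ {u} → u ∈ FS ε → ∀ {x} → x ∈ DeltaOf u → x ∈ Δε ε
  DeltaOf-FS⊆Δε u∈FS x∈ = there (∈-concatMap⁺ DeltaOf (lose u∈FS x∈))

module _ {n : ℕ} (σ : Letter n) (ex : ℕ → ℤ) (i : Fin n) (v : Word n) where

  ∈-opt : ∀ j t → t ∈ opt σ ex i v j t
  ∈-opt zero    t = here refl
  ∈-opt (suc _) t = here refl

  ∈-DeltaGen-atom : ∀ m → (atm i (ex m) ∷ v) ∈ DeltaGen σ ex i v m
  ∈-DeltaGen-atom m =
    there (∈-concatMap⁺ (λ j → blocks σ ex i v j (m ∸ j)) (lose (∈-upTo⁺ (n<1+n m)) ∈-last-block))
    where
    ∈-last-block : (atm i (ex m) ∷ v) ∈ blocks σ ex i v m (m ∸ m)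
    ∈-last-block = subst (λ d → (atm i (ex m) ∷ v) ∈ blocks σ ex i v m d)
                         (sym (n∸n≡0 m)) (∈-opt m (atm i (ex m) ∷ v))

∈-Delta-base : ∀ {n} (i : Fin n) m v → v ∈ Delta i m v
∈-Delta-base i (+ _)    v = here refl
∈-Delta-base i -[1+ _ ] v = here refl

∈-Delta-atom : ∀ {n} (i : Fin n) m v → (atm i m ∷ v) ∈ Delta i m v
∈-Delta-atom i (+ k)    v = ∈-DeltaGen-atom minus _ i v k
∈-Delta-atom i -[1+ k ] v = ∈-DeltaGen-atom plus _ i v (suc k)

module _ {n : ℕ} (ε : Equation n) {q : ℕ} (φ : Word n → Fin q)
         (C : IsCompatibleSurjection ε φ) where
  open IsCompatibleSurjection C

  surjectionDiagram : Diagram n q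
  surjectionDiagram = record { cov = covφ ε φ ; cov-ok = condii ; f = gφ ε φ ; f-ok = condi }

  ψ-surjectionDiagram : ∀ w → embed w ∈ FS ε → ψ surjectionDiagram w (φ []) (φ (embed w))
  ψ-surjectionDiagram []            _    = refl
  ψ-surjectionDiagram ((i , m) ∷ w) w∈FS =
    φ (embed w) , ψ-surjectionDiagram w (FS-∷⁻ ε w∈FS) ,
    condiii i m (embed w) (DeltaOf-FS⊆Δε ε w∈FS (∈-Delta-base i m (embed w)))
                          (DeltaOf-FS⊆Δε ε w∈FS (∈-Delta-atom i m (embed w)))

theorem3p6 : ∀ {n : ℕ} (ε : Equation n) (q : ℕ) (φ : Word n → Fin q) →
    IsCompatibleSurjection ε φ → FailsInSurj ε φ →
    ∃[ N ] (N ≤ cardΔε ε × ∃[ D ] FailsInDiagram {n} {N} ε D)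
theorem3p6 ε q φ C fails =
  q , surjective⇒≤-length-deduplicate _≟W_ (Δε ε) φ onto ,
  surjectionDiagram ε φ C , φ [] ,
  λ w w∈ε → φ (embed w) , ψ-surjectionDiagram ε φ C w (embed-∈-FS ε w∈ε) , fails w w∈ε
  where open IsCompatibleSurjection C using (onto)
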